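{- For every integer $n\geq 1$ there is a bijection $f:\mathbf{C}_n\to\mathbf{C}_n$ such that for every $P\in\mathbf{C}_n$: if $n$ is odd then $\mathrm{bck}(P)=\mathrm{ver}(f(P))$, and if $n$ is even then $\mathrm{bck}(P)=\mathrm{white}(f(P))$. (Equivalently, on Catalan words of odd length, resp. even length, there is a length-preserving bijection carrying the black cell capacity to the vertical black cell capacity, resp. vertical white cell capacity.)
   Context: A Catalan word of length $n\geq1$ is a sequence $w_1\cdots w_n$ of nonnegative integers with $w_1=0$ and $w_i\leq w_{i-1}+1$ for $2\leq i\leq n$. Its Catalan polyomino is the bargraph whose $i$th column (from the left) consists of $w_i+1$ unit cells, all columns aligned along a common bottom line. $\mathbf{C}_n$ denotes the set of Catalan polyominoes with $n$ columns. Color the cells in a chessboard pattern with the southwestern cell black: the cell in column $j$ (counted from the left, starting at 1) and row $r$ (counted from the bottom, starting at 1) is black iff $j+r$ is even. $\mathrm{bck}(P)$ is the number of black cells of $P$; $\mathrm{ver}(P)$ is the total number of cells in the columns of odd index of $P$; $\mathrm{white}(P)$ is the total number of cells in the columns of even index of $P$. -}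

module Defs where

open import Data.Nat using (ℕ; zero; suc; _+_; _≤_; _%_)
open import Data.Vec using (Vec; []; _∷_)
open import Data.Product using (Σ; _×_; _,_)
import Relation.Nullary
import Data.Nat
open import Data.Unit using (⊤)
open import Relation.Binary.PropositionalEquality using (_≡_)

StepsOK : ℕ → {n : ℕ} → Vec ℕ n → Set
StepsOK prev []       = ⊤
StepsOK prev (x ∷ xs) = (x ≤ suc prev) × StepsOK x xs

IsCatalan : {n : ℕ} → Vec ℕ n → Set
IsCatalan []       = ⊤
IsCatalan (x ∷ xs) = (x ≡ 0) × StepsOK x xs

-- C n : Catalan polyominoes with n columns (identified with Catalan words of length n;
-- column i has w_i + 1 cells).
C : ℕ → Set
C n = Σ (Vec ℕ n) IsCatalan

blackInColumn : (j h : ℕ) → ℕ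
blackInColumn j zero    = 0
blackInColumn j (suc h) with (j + suc h) % 2
... | zero  = suc (blackInColumn j h)
... | suc _ = blackInColumn j h

bckFrom : (j : ℕ) → {n : ℕ} → Vec ℕ n → ℕ
bckFrom j []       = 0
bckFrom j (w ∷ ws) = blackInColumn j (suc w) + bckFrom (suc j) ws

bck : {n : ℕ} → C n → ℕ
bck (w , _) = bckFrom 1 w

cellsFrom : (parity j : ℕ) → {n : ℕ} → Vec ℕ n → ℕ
cellsFrom p j []       = 0
cellsFrom p j (w ∷ ws) with j % 2 Data.Nat.≟ p
... | Relation.Nullary.yes _ = suc w + cellsFrom p (suc j) ws
... | Relation.Nullary.no  _ = cellsFrom p (suc j) ws

ver : {n : ℕ} → C n → ℕ
ver (w , _) = cellsFrom 1 1 w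

white : {n : ℕ} → C n → ℕ
white (w , _) = cellsFrom 0 1 w

{-# OPTIONS --safe #-}
-- Reverse the Catalan word w₁⋯wₙ of P and lay its columns down as rows, last column first:
-- a column of height wᵢ + 1 becomes a new leftmost column of height 0 followed by raising the
-- next wᵢ columns by one. Cell (i, r) of P (column i, row r) thus lands in column n − i + r of
-- f(P), and n − i + r ≡ n + (i + r) (mod 2): the black cells of P are exactly the cells of f(P)
-- in the columns with the parity of n, counted by ver for odd n and by white for even n.
-- The result is Catalan because wᵢ₊₁ ≤ wᵢ + 1 lets each new strip climb the staircase
-- 0, 1, 2, … left by the previous one; conversely wᵢ is the length of the maximal staircase
-- 1, 2, 3, … after the leading 0, so the construction can be undone strip by strip.
module Submission where

open import Defs
open import Data.Nat using (ℕ; zero; suc; pred; parity; _+_; _≤_; _%_; _≥_; z≤n; s≤s; s≤s⁻¹; _≟_)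
open import Data.Nat.Properties
  using ( +-suc; +-assoc; +-comm; +-identityʳ; ≤-refl; ≤-trans; m≤n⇒m≤1+n; ≤∧≢⇒<; n≮n; n≤0⇒n≡0
        ; suc-injective; ≤-irrelevant; ≡-irrelevant)
open import Data.Parity.Base using (Parity; 0ℙ; 1ℙ)
open import Data.Parity.Properties using (+-homo-+)
open import Data.Product using (Σ; _×_; _,_; proj₁; proj₂; map₁)
open import Data.Unit using (⊤; tt)
open import Data.Vec using (Vec; []; _∷_; _∷ʳ_; reverse; last; tail)
open import Data.Vec.Properties using (reverse-∷; reverse-involutive; last-reverse)
open import Function.Bundles using (Bijection; _⤖_; mk↔ₛ′)
open import Function.Properties.Inverse using (↔⇒⤖)
open import Relation.Nullary using (yes; no; contradiction; Irrelevant)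
open import Relation.Binary.PropositionalEquality
  using (_≡_; refl; sym; trans; cong; cong₂; subst; module ≡-Reasoning)

variable
  n : ℕ

incFirst : ℕ → Vec ℕ n → Vec ℕ n
incFirst zero    v       = v
incFirst (suc x) []      = []
incFirst (suc x) (a ∷ v) = suc a ∷ incFirst x v

decFirst : ℕ → Vec ℕ n → Vec ℕ n
decFirst zero    v       = v
decFirst (suc x) []      = []
decFirst (suc x) (a ∷ v) = pred a ∷ decFirst x v

decFirst-incFirst : ∀ x (v : Vec ℕ n) → decFirst x (incFirst x v) ≡ v
decFirst-incFirst zero    v       = refl
decFirst-incFirst (suc x) []      = refl
decFirst-incFirst (suc x) (a ∷ v) = cong (a ∷_) (decFirst-incFirst x v)

StepsOK-suc : ∀ j (v : Vec ℕ n) → StepsOK j v → StepsOK (suc j) v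
StepsOK-suc j []      _          = tt
StepsOK-suc j (a ∷ v) (a≤ , ok) = m≤n⇒m≤1+n a≤ , ok

staircase : ℕ → Vec ℕ n → ℕ
staircase k []      = 0
staircase k (a ∷ v) with a ≟ k
... | yes _ = suc (staircase (suc k) v)
... | no  _ = 0

staircase-self : ∀ k (v : Vec ℕ n) → staircase k (k ∷ v) ≡ suc (staircase (suc k) v)
staircase-self k v with k ≟ k
... | yes _  = refl
... | no k≢k = contradiction refl k≢k

staircase-unreachable : ∀ j (v : Vec ℕ n) → StepsOK j v → staircase (suc (suc j)) v ≡ 0
staircase-unreachable j []      _        = refl
staircase-unreachable j (a ∷ v) (a≤ , _) with a ≟ suc (suc j)
... | yes refl = contradiction a≤ (n≮n (suc j))
... | no  _    = refl

staircase-incFirst : ∀ j x (v : Vec ℕ n) → StepsOK j v → x ≤ staircase (suc j) v →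
                     staircase (suc (suc j)) (incFirst x v) ≡ x
staircase-incFirst j zero    v       ok _ = staircase-unreachable j v ok
staircase-incFirst j (suc x) []      _  ()
staircase-incFirst j (suc x) (a ∷ v) (_ , ok) x< with a ≟ suc j
staircase-incFirst j (suc x) (a ∷ v) (_ , ok) () | no _
... | yes refl = trans (staircase-self (suc (suc j)) (incFirst x v))
                       (cong suc (staircase-incFirst (suc j) x v ok (s≤s⁻¹ x<)))

StepsOK-incFirst : ∀ j x (v : Vec ℕ n) → StepsOK j v → x ≤ staircase (suc j) v →
                   StepsOK (suc j) (incFirst x v)
StepsOK-incFirst j zero    v       ok _ = StepsOK-suc j v ok
StepsOK-incFirst j (suc x) []      _  _ = tt
StepsOK-incFirst j (suc x) (a ∷ v) (_ , ok) x< with a ≟ suc j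
StepsOK-incFirst j (suc x) (a ∷ v) (_ , ok) () | no _
... | yes refl = ≤-refl , StepsOK-incFirst (suc j) x v ok (s≤s⁻¹ x<)

incFirst-decFirst : ∀ j x (v : Vec ℕ n) → x ≤ staircase (suc j) v → incFirst x (decFirst x v) ≡ v
incFirst-decFirst j zero    v       _  = refl
incFirst-decFirst j (suc x) []      _  = refl
incFirst-decFirst j (suc x) (a ∷ v) x< with a ≟ suc j
incFirst-decFirst j (suc x) (a ∷ v) () | no _
... | yes refl = cong (suc j ∷_) (incFirst-decFirst (suc j) x v (s≤s⁻¹ x<))

StepsOK-decFirst : ∀ j x (v : Vec ℕ n) → StepsOK (suc j) v → x ≡ staircase (suc (suc j)) v →
                   StepsOK j (decFirst x v)
StepsOK-decFirst j zero    []      _          _ = tt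
StepsOK-decFirst j zero    (a ∷ v) (a≤ , ok) x≡ with a ≟ suc (suc j)
StepsOK-decFirst j zero    (a ∷ v) (a≤ , ok) () | yes _
... | no a≢ = s≤s⁻¹ (≤∧≢⇒< a≤ a≢) , ok
StepsOK-decFirst j (suc x) []      _          _ = tt
StepsOK-decFirst j (suc x) (a ∷ v) (a≤ , ok) x≡ with a ≟ suc (suc j)
StepsOK-decFirst j (suc x) (a ∷ v) (a≤ , ok) () | no _
... | yes refl = ≤-refl , StepsOK-decFirst (suc j) x v ok (suc-injective x≡)

staircase-decFirst : ∀ j x (v : Vec ℕ n) → x ≤ staircase (suc j) v → x ≤ staircase j (decFirst x v)
staircase-decFirst j zero    v       _  = z≤n
staircase-decFirst j (suc x) []      ()
staircase-decFirst j (suc x) (a ∷ v) x< with a ≟ suc j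
staircase-decFirst j (suc x) (a ∷ v) () | no _
... | yes refl = subst (suc x ≤_) (sym (staircase-self j (decFirst x v)))
                       (s≤s (staircase-decFirst (suc j) x v (s≤s⁻¹ x<)))

IsRevCatalan : Vec ℕ n → Set
IsRevCatalan []          = ⊤
IsRevCatalan (x ∷ [])    = x ≡ 0
IsRevCatalan (x ∷ y ∷ u) = x ≤ suc y × IsRevCatalan (y ∷ u)

IsRevCatalan-head≤length : ∀ x (u : Vec ℕ n) → IsRevCatalan (x ∷ u) → x ≤ n
IsRevCatalan-head≤length x []      refl      = z≤n
IsRevCatalan-head≤length x (y ∷ u) (x≤ , rc) = ≤-trans x≤ (s≤s (IsRevCatalan-head≤length y u rc))

IsRevCatalan-tail : ∀ x (u : Vec ℕ n) → IsRevCatalan (x ∷ u) → IsRevCatalan u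
IsRevCatalan-tail x []      _        = tt
IsRevCatalan-tail x (y ∷ u) (_ , rc) = rc

StepsOK-∷ʳ⁺ : ∀ a (r : Vec ℕ n) x → StepsOK a r → x ≤ suc (last (a ∷ r)) → StepsOK a (r ∷ʳ x)
StepsOK-∷ʳ⁺ a []      x _          x≤ = x≤ , tt
StepsOK-∷ʳ⁺ a (b ∷ r) x (b≤ , ok) x≤ = b≤ , StepsOK-∷ʳ⁺ b r x ok x≤

StepsOK-∷ʳ⁻ : ∀ a (r : Vec ℕ n) x → StepsOK a (r ∷ʳ x) → StepsOK a r × x ≤ suc (last (a ∷ r))
StepsOK-∷ʳ⁻ a []      x (x≤ , _)  = tt , x≤
StepsOK-∷ʳ⁻ a (b ∷ r) x (b≤ , ok) = map₁ (b≤ ,_) (StepsOK-∷ʳ⁻ b r x ok)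

IsCatalan-∷ʳ⁺ : ∀ (v : Vec ℕ (suc n)) x → IsCatalan v → x ≤ suc (last v) → IsCatalan (v ∷ʳ x)
IsCatalan-∷ʳ⁺ (a ∷ r) x (a≡0 , ok) x≤ = a≡0 , StepsOK-∷ʳ⁺ a r x ok x≤

IsCatalan-∷ʳ⁻ : ∀ (v : Vec ℕ (suc n)) x → IsCatalan (v ∷ʳ x) → IsCatalan v × x ≤ suc (last v)
IsCatalan-∷ʳ⁻ (a ∷ r) x (a≡0 , ok) = map₁ (a≡0 ,_) (StepsOK-∷ʳ⁻ a r x ok)

IsRevCatalan⇒IsCatalan-reverse : ∀ (u : Vec ℕ n) → IsRevCatalan u → IsCatalan (reverse u)
IsRevCatalan⇒IsCatalan-reverse []          _         = tt
IsRevCatalan⇒IsCatalan-reverse (x ∷ [])    x≡0       = x≡0 , tt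
IsRevCatalan⇒IsCatalan-reverse (x ∷ y ∷ u) (x≤ , rc) =
  subst IsCatalan (sym (reverse-∷ x (y ∷ u)))
    (IsCatalan-∷ʳ⁺ (reverse (y ∷ u)) x (IsRevCatalan⇒IsCatalan-reverse (y ∷ u) rc)
      (subst (λ t → x ≤ suc t) (sym (last-reverse (y ∷ u))) x≤))

IsCatalan-reverse⇒IsRevCatalan : ∀ (u : Vec ℕ n) → IsCatalan (reverse u) → IsRevCatalan u
IsCatalan-reverse⇒IsRevCatalan []          _ = tt
IsCatalan-reverse⇒IsRevCatalan (x ∷ [])    c = proj₁ c
IsCatalan-reverse⇒IsRevCatalan (x ∷ y ∷ u) c =
  let c′ , x≤ = IsCatalan-∷ʳ⁻ (reverse (y ∷ u)) x (subst IsCatalan (reverse-∷ x (y ∷ u)) c)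
  in subst (λ t → x ≤ suc t) (last-reverse (y ∷ u)) x≤ , IsCatalan-reverse⇒IsRevCatalan (y ∷ u) c′

IsCatalan⇒IsRevCatalan-reverse : ∀ (w : Vec ℕ n) → IsCatalan w → IsRevCatalan (reverse w)
IsCatalan⇒IsRevCatalan-reverse w c =
  IsCatalan-reverse⇒IsRevCatalan (reverse w) (subst IsCatalan (sym (reverse-involutive w)) c)

layDown : Vec ℕ n → Vec ℕ n
layDown []      = []
layDown (x ∷ u) = 0 ∷ incFirst x (layDown u)

standUp : Vec ℕ n → Vec ℕ n
standUp []      = []
standUp (_ ∷ v) = staircase 1 v ∷ standUp (decFirst (staircase 1 v) v)

incFirst-layDown : ∀ x (u : Vec ℕ n) → IsRevCatalan (x ∷ u) →
                   StepsOK 0 (incFirst x (layDown u)) × staircase 1 (incFirst x (layDown u)) ≡ x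
incFirst-layDown x       []      refl      = tt , refl
incFirst-layDown zero    (y ∷ u) (_ , rc)  = (z≤n , proj₁ (incFirst-layDown y u rc)) , refl
incFirst-layDown {suc n} (suc x) (y ∷ u) (x≤ , rc) =
  (≤-refl , StepsOK-incFirst 0 x v ok x≤staircase) , cong suc (staircase-incFirst 0 x v ok x≤staircase)
  where
  v : Vec ℕ n
  v = incFirst y (layDown u)
  ok : StepsOK 0 v
  ok = proj₁ (incFirst-layDown y u rc)
  x≤staircase : x ≤ staircase 1 v
  x≤staircase = subst (x ≤_) (sym (proj₂ (incFirst-layDown y u rc))) (s≤s⁻¹ x≤)

layDown-isCatalan : ∀ (u : Vec ℕ n) → IsRevCatalan u → IsCatalan (layDown u)
layDown-isCatalan []      _  = tt
layDown-isCatalan (x ∷ u) rc = refl , proj₁ (incFirst-layDown x u rc)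

standUp-layDown : ∀ (u : Vec ℕ n) → IsRevCatalan u → standUp (layDown u) ≡ u
standUp-layDown []      _  = refl
standUp-layDown (x ∷ u) rc rewrite proj₂ (incFirst-layDown x u rc) | decFirst-incFirst x (layDown u) =
  cong (x ∷_) (standUp-layDown u (IsRevCatalan-tail x u rc))

decFirst-staircase-isCatalan : ∀ (v : Vec ℕ n) → StepsOK 0 v → IsCatalan (decFirst (staircase 1 v) v)
decFirst-staircase-isCatalan []      _         = tt
decFirst-staircase-isCatalan (a ∷ v) (a≤ , ok) with a ≟ 1
... | yes refl = refl , StepsOK-decFirst 0 (staircase 2 v) v ok refl
... | no a≢1   = n≤0⇒n≡0 (s≤s⁻¹ (≤∧≢⇒< a≤ a≢1)) , ok

layDown-standUp : ∀ (v : Vec ℕ n) → IsCatalan v → layDown (standUp v) ≡ v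
layDown-standUp []       _         = refl
layDown-standUp (.0 ∷ v) (refl , ok) = cong (0 ∷_) (begin
  incFirst s (layDown (standUp (decFirst s v)))
    ≡⟨ cong (incFirst s) (layDown-standUp (decFirst s v) (decFirst-staircase-isCatalan v ok)) ⟩
  incFirst s (decFirst s v)
    ≡⟨ incFirst-decFirst 0 s v ≤-refl ⟩
  v ∎)
  where
  open ≡-Reasoning
  s : ℕ
  s = staircase 1 v

staircase-decFirst-tail : ∀ (v : Vec ℕ (suc n)) →
                          staircase 1 v ≤ suc (staircase 1 (tail (decFirst (staircase 1 v) v)))
staircase-decFirst-tail (a ∷ v) with a ≟ 1
... | yes _ = s≤s (staircase-decFirst 1 (staircase 2 v) v ≤-refl)
... | no  _ = z≤n

standUp-isRevCatalan : ∀ (v : Vec ℕ n) → IsCatalan v → IsRevCatalan (standUp v)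
standUp-isRevCatalan []           _           = tt
standUp-isRevCatalan (.0 ∷ [])    (refl , _)  = refl
standUp-isRevCatalan (.0 ∷ a ∷ v) (refl , ok) =
  cons (decFirst s (a ∷ v)) (staircase-decFirst-tail (a ∷ v))
       (standUp-isRevCatalan _ (decFirst-staircase-isCatalan (a ∷ v) ok))
  where
  s : ℕ
  s = staircase 1 (a ∷ v)
  cons : ∀ (w : Vec ℕ (suc n)) → s ≤ suc (staircase 1 (tail w)) →
         IsRevCatalan (standUp w) → IsRevCatalan (s ∷ standUp w)
  cons (_ ∷ _) s≤ rc = s≤ , rc

parityCount : ℕ → ℕ → ℕ → ℕ
parityCount p k zero    = 0
parityCount p k (suc h) with k % 2 ≟ p
... | yes _ = suc (parityCount p (suc k) h)
... | no  _ = parityCount p (suc k) h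

cellsFrom-incFirst : ∀ p k x (v : Vec ℕ n) → x ≤ n →
                     cellsFrom p k (incFirst x v) ≡ cellsFrom p k v + parityCount p k x
cellsFrom-incFirst p k zero    v       _        = sym (+-identityʳ _)
cellsFrom-incFirst p k (suc x) (a ∷ v) (s≤s x≤) with k % 2 ≟ p
... | no  _ = cellsFrom-incFirst p (suc k) x v x≤
... | yes _ = begin
  suc (suc a) + cellsFrom p (suc k) (incFirst x v)
    ≡⟨ cong (suc (suc a) +_) (cellsFrom-incFirst p (suc k) x v x≤) ⟩
  suc (suc a) + (c + q)
    ≡⟨ cong suc (sym (trans (+-suc (a + c) q) (cong suc (+-assoc a c q)))) ⟩
  suc a + c + suc q ∎
  where
  open ≡-Reasoning
  c q : ℕ
  c = cellsFrom p (suc k) v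
  q = parityCount p (suc k) x

cellsFrom-0∷incFirst : ∀ p k x (v : Vec ℕ n) → x ≤ n →
                       cellsFrom p k (0 ∷ incFirst x v) ≡ cellsFrom p (suc k) v + parityCount p k (suc x)
cellsFrom-0∷incFirst p k x v x≤ with k % 2 ≟ p
... | yes _ = trans (cong suc (cellsFrom-incFirst p (suc k) x v x≤)) (sym (+-suc _ _))
... | no  _ = cellsFrom-incFirst p (suc k) x v x≤

bckFrom-∷ʳ : ∀ j (v : Vec ℕ n) x → bckFrom j (v ∷ʳ x) ≡ bckFrom j v + blackInColumn (j + n) (suc x)
bckFrom-∷ʳ j []      x rewrite +-identityʳ j = +-identityʳ _
bckFrom-∷ʳ {suc n} j (a ∷ v) x rewrite bckFrom-∷ʳ (suc j) v x | +-suc j n =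
  sym (+-assoc (blackInColumn j (suc a)) (bckFrom (suc j) v) _)

δ : ℕ → ℕ → ℕ
δ a b with a ≟ b
... | yes _ = 1
... | no  _ = 0

parityCount-suc : ∀ p k h → parityCount p k (suc h) ≡ parityCount p k h + δ ((k + h) % 2) p
parityCount-suc p k zero    rewrite +-identityʳ k with k % 2 ≟ p
... | yes _ = refl
... | no  _ = refl
parityCount-suc p k (suc h) rewrite +-suc k h with k % 2 ≟ p
... | yes _ = cong suc (parityCount-suc p (suc k) h)
... | no  _ = parityCount-suc p (suc k) h

blackInColumn-suc : ∀ m h → blackInColumn m (suc h) ≡ δ ((m + suc h) % 2) 0 + blackInColumn m h
blackInColumn-suc m h with (m + suc h) % 2
... | zero  = refl
... | suc _ = refl

parityToℕ : Parity → ℕ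
parityToℕ 0ℙ = 0
parityToℕ 1ℙ = 1

%2≡parityToℕ : ∀ m → m % 2 ≡ parityToℕ (parity m)
%2≡parityToℕ zero          = refl
%2≡parityToℕ (suc zero)    = refl
%2≡parityToℕ (suc (suc m)) = %2≡parityToℕ m

black-row≡column-class : ∀ k m h → δ ((m + suc h) % 2) 0 ≡ δ ((k + h) % 2) ((suc k + m) % 2)
black-row≡column-class k m h
  rewrite %2≡parityToℕ (m + suc h) | %2≡parityToℕ (k + h) | %2≡parityToℕ (suc k + m)
        | +-homo-+ m (suc h) | +-homo-+ k h | +-homo-+ (suc k) m | +-homo-+ 1 h | +-homo-+ 1 k
  with parity k | parity m | parity h
... | 0ℙ | 0ℙ | 0ℙ = refl
... | 0ℙ | 0ℙ | 1ℙ = refl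
... | 0ℙ | 1ℙ | 0ℙ = refl
... | 0ℙ | 1ℙ | 1ℙ = refl
... | 1ℙ | 0ℙ | 0ℙ = refl
... | 1ℙ | 0ℙ | 1ℙ = refl
... | 1ℙ | 1ℙ | 0ℙ = refl
... | 1ℙ | 1ℙ | 1ℙ = refl

-- Row r of column m is laid down in column k + r − 1; it is black iff m + r is even,
-- that is, iff k + r − 1 ≡ k + 1 + m (mod 2).
blackInColumn≡parityCount : ∀ m k h → blackInColumn m h ≡ parityCount ((suc k + m) % 2) k h
blackInColumn≡parityCount m k zero    = refl
blackInColumn≡parityCount m k (suc h) = begin
  blackInColumn m (suc h)
    ≡⟨ blackInColumn-suc m h ⟩
  δ ((m + suc h) % 2) 0 + blackInColumn m h
    ≡⟨ cong₂ _+_ (black-row≡column-class k m h) (blackInColumn≡parityCount m k h) ⟩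
  δ ((k + h) % 2) p + parityCount p k h
    ≡⟨ +-comm (δ ((k + h) % 2) p) (parityCount p k h) ⟩
  parityCount p k h + δ ((k + h) % 2) p
    ≡⟨ parityCount-suc p k h ⟨
  parityCount p k (suc h) ∎
  where
  open ≡-Reasoning
  p : ℕ
  p = (suc k + m) % 2

bckFrom-reverse≡cellsFrom-layDown : ∀ (u : Vec ℕ n) → IsRevCatalan u → ∀ j k →
                                    bckFrom j (reverse u) ≡ cellsFrom ((k + (j + n)) % 2) k (layDown u)
bckFrom-reverse≡cellsFrom-layDown []               _  j k = refl
bckFrom-reverse≡cellsFrom-layDown {suc n} (x ∷ u) rc j k = begin
  bckFrom j (reverse (x ∷ u))
    ≡⟨ cong (bckFrom j) (reverse-∷ x u) ⟩
  bckFrom j (reverse u ∷ʳ x)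
    ≡⟨ bckFrom-∷ʳ j (reverse u) x ⟩
  bckFrom j (reverse u) + blackInColumn (j + n) (suc x)
    ≡⟨ cong₂ _+_ (bckFrom-reverse≡cellsFrom-layDown u (IsRevCatalan-tail x u rc) j (suc k))
                 (blackInColumn≡parityCount (j + n) k (suc x)) ⟩
  cellsFrom p (suc k) (layDown u) + parityCount p k (suc x)
    ≡⟨ sym (cellsFrom-0∷incFirst p k x (layDown u) (IsRevCatalan-head≤length x u rc)) ⟩
  cellsFrom p k (layDown (x ∷ u))
    ≡⟨ cong (λ t → cellsFrom (t % 2) k (layDown (x ∷ u))) (sym k+[j+1+n]≡1+k+[j+n]) ⟩
  cellsFrom ((k + (j + suc n)) % 2) k (layDown (x ∷ u)) ∎
  where
  open ≡-Reasoning
  p : ℕ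
  p = (suc k + (j + n)) % 2
  k+[j+1+n]≡1+k+[j+n] : k + (j + suc n) ≡ suc k + (j + n)
  k+[j+1+n]≡1+k+[j+n] = trans (cong (k +_) (+-suc j n)) (+-suc k (j + n))

StepsOK-irrelevant : ∀ j (v : Vec ℕ n) → Irrelevant (StepsOK j v)
StepsOK-irrelevant j []      tt       tt       = refl
StepsOK-irrelevant j (a ∷ v) (p , ok) (q , ok′) =
  cong₂ _,_ (≤-irrelevant p q) (StepsOK-irrelevant a v ok ok′)

IsCatalan-irrelevant : ∀ (v : Vec ℕ n) → Irrelevant (IsCatalan v)
IsCatalan-irrelevant []      tt       tt        = refl
IsCatalan-irrelevant (a ∷ v) (p , ok) (q , ok′) =
  cong₂ _,_ (≡-irrelevant p q) (StepsOK-irrelevant a v ok ok′)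

C-≡ : {P Q : C n} → proj₁ P ≡ proj₁ Q → P ≡ Q
C-≡ {P = v , c} {Q = .v , c′} refl = cong (v ,_) (IsCatalan-irrelevant v c c′)

layDownᶜ : C n → C n
layDownᶜ (w , c) =
  layDown (reverse w) , layDown-isCatalan (reverse w) (IsCatalan⇒IsRevCatalan-reverse w c)

standUpᶜ : C n → C n
standUpᶜ (v , c) =
  reverse (standUp v) , IsRevCatalan⇒IsCatalan-reverse (standUp v) (standUp-isRevCatalan v c)

layDownᶜ-standUpᶜ : ∀ (P : C n) → layDownᶜ (standUpᶜ P) ≡ P
layDownᶜ-standUpᶜ (v , c) =
  C-≡ (trans (cong layDown (reverse-involutive (standUp v))) (layDown-standUp v c))

standUpᶜ-layDownᶜ : ∀ (P : C n) → standUpᶜ (layDownᶜ P) ≡ P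
standUpᶜ-layDownᶜ (w , c) =
  C-≡ (trans (cong reverse (standUp-layDown (reverse w) (IsCatalan⇒IsRevCatalan-reverse w c)))
             (reverse-involutive w))

layDown-⤖ : C n ⤖ C n
layDown-⤖ = ↔⇒⤖ (mk↔ₛ′ layDownᶜ standUpᶜ layDownᶜ-standUpᶜ standUpᶜ-layDownᶜ)

bck≡cellsFrom-layDownᶜ : ∀ {p} (P : C n) → n % 2 ≡ p → bck P ≡ cellsFrom p 1 (proj₁ (layDownᶜ P))
bck≡cellsFrom-layDownᶜ {n = n} (w , c) refl = begin
  bckFrom 1 w
    ≡⟨ cong (bckFrom 1) (sym (reverse-involutive w)) ⟩
  bckFrom 1 (reverse (reverse w))
    ≡⟨ bckFrom-reverse≡cellsFrom-layDown (reverse w) (IsCatalan⇒IsRevCatalan-reverse w c) 1 1 ⟩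
  cellsFrom (n % 2) 1 (layDown (reverse w)) ∎
  where open ≡-Reasoning

theorem1p1 : (n : ℕ) → n ≥ 1 →
    Σ (C n ⤖ C n) λ f → (P : C n) →
      ((n % 2 ≡ 1 → bck P ≡ ver (Bijection.to f P))
      × (n % 2 ≡ 0 → bck P ≡ white (Bijection.to f P)))
theorem1p1 n _ = layDown-⤖ , λ P → bck≡cellsFrom-layDownᶜ P , bck≡cellsFrom-layDownᶜ P
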